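{- Let $\alpha\in(0,1)$ be irrational, $v_0(n)=1_{[1-\alpha,1)}(n\alpha\bmod 1)$, and let $f$, $g$ be as in the context. Then for every $n\ge2$, $f(n)$ is the smallest natural number $N$ satisfying both (i) $f(n-1)+1\le N$ and (ii) $g(n)\le N$.
   Context: For $n\ge1$ let $P_n$ be the set of words of length $n$ occurring as factors of $v_0\in\{0,1\}^{\mathbf{Z}}$. It is known that $|P_n|=n+1$ and that for each $n\ge1$ there is a unique $t_n\in P_n$ with $t_n1\in P_{n+1}$ and $t_n0\in P_{n+1}$, while every $a\in P_n\setminus\{t_n\}$ has exactly one letter $C(a)\in\{0,1\}$ with $aC(a)\in P_{n+1}$. Let $f(n)$ be the smallest $N\in\mathbf{N}$ such that every word of $P_n$ occurs as a factor of $(v_0(1),\dots,v_0(N))$, and let $g(n)$ ($n\ge2$) be the smallest $N$ such that both $t_{n-1}1$ and $t_{n-1}0$ occur as factors of $(v_0(1),\dots,v_0(N))$. -}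

module Defs where

open import Data.Bool using (Bool; true; false)
open import Data.Nat as ℕ using (ℕ; zero; suc)
open import Data.Integer as ℤ using (ℤ; +_; -[1+_]; +[1+_])
open import Data.Rational as ℚ using (ℚ; 0ℚ; 1ℚ; _/_)
open import Data.Fin using (Fin; toℕ)
open import Data.Vec using (Vec; lookup; _∷ʳ_)
open import Data.Product using (Σ; ∃; _×_)
open import Relation.Nullary using (¬_)
open import Relation.Binary.PropositionalEquality using (_≡_)
open import Function.Bundles using (_⇔_)

-- An irrational number α ∈ (0,1), given by its (lower) Dedekind cut:
-- below q  means  q < α.  "upper-open" (the complement {q | ¬ q < α} has
-- no least element) is exactly irrationality of α; below 0 / ¬ below 1
-- together with the openness conditions give 0 < α < 1.
record Irrational01 : Set₁ where
  field
    below       : ℚ → Set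
    down-closed : ∀ {p q} → p ℚ.≤ q → below q → below p
    lower-open  : ∀ {q} → below q → ∃ λ r → q ℚ.< r × below r
    upper-open  : ∀ {q} → ¬ below q → ∃ λ r → r ℚ.< q × ¬ below r
    zero-below  : below 0ℚ
    one-above   : ¬ below 1ℚ

module _ (α : Irrational01) where
  open Irrational01 α

  -- LeA k m  :⇔  k ≤ m·α   (k, m ∈ ℤ).  (For m > 0 we use k/m ≤ α ⇔ k/m < α,
  -- valid since α is irrational; for m < 0, k ≤ mα ⇔ α ≤ (-k)/|m| ⇔ ¬ ((-k)/|m| < α).)
  LeA : ℤ → ℤ → Set
  LeA k (+ zero)    = k ℤ.≤ + 0
  LeA k +[1+ p ]    = below (k / suc p)
  LeA k -[1+ p ]    = ¬ below ((ℤ.- k) / suc p)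

  IsFloor : ℤ → ℤ → Set
  IsFloor m k = LeA k m × ¬ LeA (k ℤ.+ + 1) m

  -- V m  :⇔  v₀(m) = 1, i.e. (mα mod 1) ∈ [1-α, 1).
  -- With k = ⌊mα⌋, mα mod 1 = mα - k < 1 always, and
  -- 1 - α ≤ mα - k  ⇔  k + 1 ≤ (m+1)α.
  V : ℤ → Set
  V m = ∃ λ k → IsFloor m k × LeA (k ℤ.+ + 1) (m ℤ.+ + 1)

  OccursAt : ∀ {n} → Vec Bool n → ℤ → Set
  OccursAt w i = ∀ j → (V (i ℤ.+ + toℕ j) ⇔ (lookup w j ≡ true))

  InP : ∀ {n} → Vec Bool n → Set
  InP w = ∃ λ (i : ℤ) → OccursAt w i

  InPrefix : ℕ → ∀ {n} → Vec Bool n → Set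
  InPrefix N {n} w = ∃ λ (i : ℕ) → (1 ℕ.≤ i) × (i ℕ.+ n ℕ.≤ suc N) × OccursAt w (+ i)

  FProp : ℕ → ℕ → Set
  FProp n N = (w : Vec Bool n) → InP w → InPrefix N w

  RightSpecial : ∀ {m} → Vec Bool m → Set
  RightSpecial t = InP (t ∷ʳ true) × InP (t ∷ʳ false)

  GProp : ∀ {m} → Vec Bool m → ℕ → Set
  GProp t N = InPrefix N (t ∷ʳ true) × InPrefix N (t ∷ʳ false)

IsLeast : (ℕ → Set) → ℕ → Set
IsLeast P N = P N × (∀ M → P M → N ℕ.≤ M)

-- v₀(1 + p) = ⌊(2 + p)α⌋ − ⌊(1 + p)α⌋, and the floors satisfy ⌊xα⌋ + ⌊yα⌋ ≤ ⌊uα⌋ + ⌊vα⌋ + 1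
-- whenever x + y = u + v; hence no word w has both 0w0 and 1w1 as factors (balance).  Two right
-- special factors of the same length that differ would, at their last difference, produce such a
-- pair, so t_{n-1} is the only right special factor of length n - 1.  Every factor of length n is
-- therefore either t_{n-1}c, which occurs in v₀(1..g(n)), or the unique right extension uc of some
-- u ≠ t_{n-1}, which occurs one letter after an occurrence of u in v₀(1..f(n-1)); this gives
-- f(n) ≤ max(f(n-1) + 1, g(n)).  Conversely every factor of length n - 1 extends to one of length n,
-- so f(n-1) + 1 ≤ f(n), and g(n) ≤ f(n) trivially.  As α is only given by its cut, floors exist
-- only up to ¬¬, which is enough for these decidable conclusions.

module Submission where

open import Defs
open import Data.Bool as Bool using (Bool; true; false)
open import Data.Bool.Properties using (⇔→≡)
open import Data.Empty using (⊥)
open import Data.Fin as Fin using (toℕ; fromℕ; fromℕ<; inject₁)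
open import Data.Fin.Properties using (toℕ-inject₁; toℕ-fromℕ; toℕ-fromℕ<; toℕ<n)
open import Data.Fin.Relation.Unary.Top using (view; ‵fromℕ; ‵inject₁)
open import Data.Integer as ℤ using (ℤ; +_; _+_; _-_; _*_; _≤_; _<_)
import Data.Integer.Properties as ℤ
open import Data.Integer.Tactic.RingSolver using (solve-∀)
open import Data.Nat as ℕ using (ℕ; zero; suc; s≤s; z≤n)
import Data.Nat.Properties as ℕ
import Data.Nat.Tactic.RingSolver as ℕ-Solver
import Data.Rational as ℚ
import Data.Rational.Properties as ℚ
import Data.Rational.Unnormalised as ℚᵘ
import Data.Rational.Unnormalised.Properties as ℚᵘ
open import Data.Product using (∃; _×_; _,_; proj₁; proj₂)
open import Data.Sum using (_⊎_; inj₁; inj₂)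
open import Data.Vec using (Vec; []; _∷_; lookup; _∷ʳ_; initLast; tabulate)
open import Data.Vec.Properties as Vec using (tabulate∘lookup; tabulate-cong)
open import Effect.Monad using (RawMonad)
open import Function using (_∘_; const; flip)
open import Function.Bundles using (_⇔_; mk⇔; Equivalence)
open import Function.Construct.Composition using (_⇔-∘_)
open import Function.Construct.Symmetry using (⇔-sym)
open import Relation.Nullary using (¬_; Dec; yes; no; does; contradiction)
open import Relation.Nullary.Decidable using (decidable-stable; ¬¬-excluded-middle)
open import Relation.Nullary.Negation using (¬¬-Monad; ¬¬-map)
open import Relation.Binary.PropositionalEquality
import Level

open Equivalence using (to; from)
open RawMonad (¬¬-Monad {Level.zero}) using (pure; _>>=_)

¬¬-pull-→ : {A B : Set} → (A → ¬ ¬ B) → ¬ ¬ (A → B)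
¬¬-pull-→ f = ¬¬-excluded-middle >>= λ where
  (yes a) → f a >>= λ b → pure (const b)
  (no ¬a) → pure (flip contradiction ¬a)

¬¬-pull-Vec : ∀ n {P : Vec Bool n → Set} → (∀ w → ¬ ¬ P w) → ¬ ¬ (∀ w → P w)
¬¬-pull-Vec zero    h = h [] >>= λ p → pure λ { [] → p }
¬¬-pull-Vec (suc n) {P} h =
  ¬¬-pull-Vec n {λ w → ∀ b → P (b ∷ w)}
    (λ w → h (true ∷ w) >>= λ p₁ → h (false ∷ w) >>= λ p₀ → pure λ { true → p₁ ; false → p₀ })
  >>= λ g → pure λ { (b ∷ w) → g w b }

¬¬-last-failure : {E : ℕ → Set} → ∀ ℓ → ¬ (∀ k → k ℕ.< ℓ → E k) →
  ¬ ¬ (∃ λ j → j ℕ.< ℓ × ¬ E j × (∀ l → j ℕ.< l → l ℕ.< ℓ → E l))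
¬¬-last-failure zero    ¬all = contradiction (λ _ ()) ¬all
¬¬-last-failure {E} (suc ℓ) ¬all = ¬¬-excluded-middle >>= last
  where
  up-to : E ℓ → ∀ {k} → (k ℕ.< ℓ → E k) → k ℕ.< suc ℓ → E k
  up-to eℓ below k<1+ℓ with ℕ.m≤n⇒m<n∨m≡n (ℕ.≤-pred k<1+ℓ)
  ... | inj₁ k<ℓ  = below k<ℓ
  ... | inj₂ refl = eℓ

  last : Dec (E ℓ) → ¬ ¬ (∃ λ j → j ℕ.< suc ℓ × ¬ E j × (∀ l → j ℕ.< l → l ℕ.< suc ℓ → E l))
  last (no ¬eℓ) = pure (ℓ , ℕ.≤-refl , ¬eℓ , λ l ℓ<l l<1+ℓ → contradiction (ℕ.≤-pred l<1+ℓ) (ℕ.<⇒≱ ℓ<l))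
  last (yes eℓ) = ¬¬-last-failure ℓ (λ all → ¬all (λ k → up-to eℓ (all k))) >>= λ (j , j<ℓ , ¬ej , after) →
    pure (j , ℕ.m<n⇒m<1+n j<ℓ , ¬ej , λ l j<l → up-to eℓ (after l j<l))

¬⇔⇒¬¬-xor : {A B : Set} → ¬ (A ⇔ B) → ¬ ¬ ((A × ¬ B) ⊎ (¬ A × B))
¬⇔⇒¬¬-xor ¬a⇔b = ¬¬-excluded-middle >>= λ where
  (yes a) → pure (inj₁ (a , λ b → ¬a⇔b (mk⇔ (const b) (const a))))
  (no ¬a) → ¬¬-excluded-middle >>= λ where
    (yes b) → pure (inj₂ (¬a , b))
    (no ¬b) → contradiction (mk⇔ (flip contradiction ¬a) (flip contradiction ¬b)) ¬a⇔b

decided⇔does : {A : Set} (d : Dec A) → A ⇔ (does d ≡ true)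
decided⇔does (yes a) = mk⇔ (const refl) (const a)
decided⇔does (no ¬a) = mk⇔ (flip contradiction ¬a) λ ()

lookup-∷ʳ-inject₁ : ∀ {A : Set} {m} (u : Vec A m) c j → lookup (u ∷ʳ c) (inject₁ j) ≡ lookup u j
lookup-∷ʳ-inject₁ (_ ∷ _) _ Fin.zero    = refl
lookup-∷ʳ-inject₁ (_ ∷ u) c (Fin.suc j) = lookup-∷ʳ-inject₁ u c j

lookup-∷ʳ-fromℕ : ∀ {A : Set} {m} (u : Vec A m) c → lookup (u ∷ʳ c) (fromℕ m) ≡ c
lookup-∷ʳ-fromℕ []      _ = refl
lookup-∷ʳ-fromℕ (_ ∷ u) c = lookup-∷ʳ-fromℕ u c

least-≤ : ∀ {P : ℕ → Set} {F M} → IsLeast P F → ¬ ¬ P M → F ℕ.≤ M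
least-≤ {F = F} {M} (_ , least) ¬¬PM = decidable-stable (F ℕ.≤? M) (¬¬-map (least M) ¬¬PM)

/-≤-cross : ∀ a b m n → a * + suc n ≤ b * + suc m → a ℚ./ suc m ℚ.≤ b ℚ./ suc n
/-≤-cross a b m n h = ℚ.toℚᵘ-cancel-≤
  (ℚᵘ.≤-respʳ-≃ (ℚᵘ.≃-sym (ℚ.toℚᵘ-fromℚᵘ (ℚᵘ.mkℚᵘ b n)))
    (ℚᵘ.≤-respˡ-≃ (ℚᵘ.≃-sym (ℚ.toℚᵘ-fromℚᵘ (ℚᵘ.mkℚᵘ a m))) (ℚᵘ.*≤* h)))

module _ (a b M N : ℤ) where
  open ℤ.≤-Reasoning

  mediant-≤ʳ : a * N ≤ b * M → (a + b) * N ≤ b * (M + N)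
  mediant-≤ʳ h = begin
    (a + b) * N   ≡⟨ ℤ.*-distribʳ-+ N a b ⟩
    a * N + b * N ≤⟨ ℤ.+-monoˡ-≤ (b * N) h ⟩
    b * M + b * N ≡⟨ ℤ.*-distribˡ-+ b M N ⟨
    b * (M + N)   ∎

  mediant-≤ˡ : b * M ≤ a * N → (a + b) * M ≤ a * (M + N)
  mediant-≤ˡ h = begin
    (a + b) * M   ≡⟨ ℤ.*-distribʳ-+ M a b ⟩
    a * M + b * M ≤⟨ ℤ.+-monoʳ-≤ (a * M) h ⟩
    a * M + a * N ≡⟨ ℤ.*-distribˡ-+ a M N ⟨
    a * (M + N)   ∎

  mediant-≥ˡ : a * N ≤ b * M → a * (M + N) ≤ (a + b) * M
  mediant-≥ˡ h = begin
    a * (M + N)   ≡⟨ ℤ.*-distribˡ-+ a M N ⟩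
    a * M + a * N ≤⟨ ℤ.+-monoʳ-≤ (a * M) h ⟩
    a * M + b * M ≡⟨ ℤ.*-distribʳ-+ M a b ⟨
    (a + b) * M   ∎

  mediant-≥ʳ : b * M ≤ a * N → b * (M + N) ≤ (a + b) * N
  mediant-≥ʳ h = begin
    b * (M + N)   ≡⟨ ℤ.*-distribˡ-+ b M N ⟩
    b * M + b * N ≤⟨ ℤ.+-monoˡ-≤ (b * N) h ⟩
    a * N + b * N ≡⟨ ℤ.*-distribʳ-+ N a b ⟨
    (a + b) * N   ∎

module Sturmian (α : Irrational01) where
  open Irrational01 α

  -- a ≺ m  stands for  a < (1 + m)·α ; the record makes a and m inferable.
  infix 4 _≺_
  record _≺_ (a : ℤ) (m : ℕ) : Set where
    constructor mk≺
    field ≺-below : below (a ℚ./ suc m)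
  open _≺_

  ≺-cross : ∀ {a m b n} → a * + suc n ≤ b * + suc m → b ≺ n → a ≺ m
  ≺-cross {a} {m} {b} {n} h (mk≺ b<) = mk≺ (down-closed (/-≤-cross a b m n h) b<)

  ≺-mono : ∀ {a b m} → a ≤ b → b ≺ m → a ≺ m
  ≺-mono {m = m} a≤b = ≺-cross (ℤ.*-monoʳ-≤-nonNeg (+ suc m) a≤b)

  0≺ : ∀ m → + 0 ≺ m
  0≺ m = ≺-cross {b = + 0} {n = 0} ℤ.≤-refl (mk≺ (subst below (sym (ℚ.0/n≡0 1)) zero-below))

  1+m⊀m : ∀ m → ¬ (+ suc m ≺ m)
  1+m⊀m m 1+m≺m = one-above (≺-below (≺-cross {+ 1} {0} (ℤ.≤-reflexive 1·M≡M·1) 1+m≺m))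
    where
    1·M≡M·1 : + 1 * + suc m ≡ + suc m * + 1
    1·M≡M·1 = trans (ℤ.*-identityˡ (+ suc m)) (sym (ℤ.*-identityʳ (+ suc m)))

  -- The cut is only known to be down-closed, so sums go through the mediant (a + b)/(M + N),
  -- which lies between a/M and b/N.
  ≺-mediant : ∀ {a m b n} → a ≺ m → b ≺ n → a + b ≺ m ℕ.+ suc n
  ≺-mediant {a} {m} {b} {n} a≺ b≺ with ℤ.≤-total (a * + suc n) (b * + suc m)
  ... | inj₁ h = ≺-cross (mediant-≤ʳ a b (+ suc m) (+ suc n) h) b≺
  ... | inj₂ h = ≺-cross (mediant-≤ˡ a b (+ suc m) (+ suc n) h) a≺

  ⊀-mediant : ∀ {a m b n} → ¬ a ≺ m → ¬ b ≺ n → ¬ a + b ≺ m ℕ.+ suc n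
  ⊀-mediant {a} {m} {b} {n} a⊀ b⊀ ab≺ with ℤ.≤-total (a * + suc n) (b * + suc m)
  ... | inj₁ h = a⊀ (≺-cross (mediant-≥ˡ a b (+ suc m) (+ suc n) h) ab≺)
  ... | inj₂ h = b⊀ (≺-cross (mediant-≥ʳ a b (+ suc m) (+ suc n) h) ab≺)

  ≺⊀⇒< : ∀ {a b m} → a ≺ m → ¬ b ≺ m → a < b
  ≺⊀⇒< {a} {b} a≺ b⊀ with b ℤ.≤? a
  ... | yes b≤a = contradiction (≺-mono b≤a a≺) b⊀
  ... | no  b≰a = ℤ.≰⇒> b≰a

  <+1⇒≤ : ∀ {i j} → i < j + + 1 → i ≤ j
  <+1⇒≤ {i} {j} i<j+1 = subst (i ≤_) (pred[j+1]≡j j) (ℤ.i<j⇒i≤pred[j] i<j+1)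
    where
    pred[j+1]≡j : ∀ j → ℤ.-1ℤ + (j + + 1) ≡ j
    pred[j+1]≡j = solve-∀

  Floor : ℕ → ℤ → Set
  Floor p k = k ≺ p × ¬ (k + + 1 ≺ p)

  ≺⇒≤-floor : ∀ {a p k} → a ≺ p → Floor p k → a ≤ k
  ≺⇒≤-floor a≺ (_ , k+1⊀) = <+1⇒≤ (≺⊀⇒< a≺ k+1⊀)

  floor-unique : ∀ {p k k′} → Floor p k → Floor p k′ → k ≡ k′
  floor-unique f f′ = ℤ.≤-antisym (≺⇒≤-floor (proj₁ f) f′) (≺⇒≤-floor (proj₁ f′) f)

  ¬¬-floor-below : ∀ p N → ¬ (+ N ≺ p) → ¬ ¬ ∃ (Floor p)
  ¬¬-floor-below p zero    0⊀ = contradiction (0≺ p) 0⊀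
  ¬¬-floor-below p (suc N) N+1⊀ = ¬¬-excluded-middle >>= λ where
    (yes N≺) → pure (+ N , N≺ , subst (λ k → ¬ k ≺ p) (cong +_ (ℕ.+-comm 1 N)) N+1⊀)
    (no  N⊀) → ¬¬-floor-below p N N⊀

  ¬¬-floor : ∀ p → ¬ ¬ ∃ (Floor p)
  ¬¬-floor p = ¬¬-floor-below p (suc p) (1+m⊀m p)

  floor-sum-< : ∀ {p q r s a b c d} → Floor p a → Floor q b → Floor r c → Floor s d →
                p ℕ.+ suc q ≡ r ℕ.+ suc s → a + b < (c + + 1) + (d + + 1)
  floor-sum-< {a = a} {b} (a≺ , _) (b≺ , _) (_ , c+1⊀) (_ , d+1⊀) eq =
    ≺⊀⇒< (subst (a + b ≺_) eq (≺-mediant a≺ b≺)) (⊀-mediant c+1⊀ d+1⊀)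

  V⁺ : ℕ → Set
  V⁺ p = V α (+ suc p)

  V⁺⇔ : ∀ {p k} → Floor p k → V⁺ p ⇔ (k + + 1 ≺ suc p)
  V⁺⇔ {p} {k} f = mk⇔ to′ from′
    where
    to′ : V⁺ p → k + + 1 ≺ suc p
    to′ (k₀ , (k₀≺ , k₀+1⊀) , k₀+1≺) with floor-unique {k = k₀} (mk≺ k₀≺ , k₀+1⊀ ∘ ≺-below) f
    ... | refl = subst (k + + 1 ≺_) (ℕ.+-comm p 1) (mk≺ k₀+1≺)
    from′ : k + + 1 ≺ suc p → V⁺ p
    from′ k+1≺ = k , (≺-below (proj₁ f) , proj₂ f ∘ mk≺)
               , ≺-below (subst (k + + 1 ≺_) (ℕ.+-comm 1 p) k+1≺)

  floor-suc-≥ : ∀ {p k k′} → Floor p k → Floor (suc p) k′ → k ≤ k′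
  floor-suc-≥ {p} {k} (k≺ , _) f′ =
    ≺⇒≤-floor (subst₂ _≺_ (ℤ.+-identityʳ k) (ℕ.+-comm p 1) (≺-mediant k≺ (0≺ 0))) f′

  floor-suc-≤ : ∀ {p k k′} → Floor p k → Floor (suc p) k′ → k′ ≤ k + + 1
  floor-suc-≤ {p} {k} (_ , k+1⊀) (k′≺ , _) =
    <+1⇒≤ (≺⊀⇒< k′≺ (subst (λ q → ¬ k + + 1 + + 1 ≺ q) (ℕ.+-comm p 1) (⊀-mediant k+1⊀ (1+m⊀m 0))))

  floor-step-V : ∀ {p k k′} → Floor p k → Floor (suc p) k′ → V⁺ p → k′ ≡ k + + 1
  floor-step-V f f′ v = ℤ.≤-antisym (floor-suc-≤ f f′) (≺⇒≤-floor (to (V⁺⇔ f) v) f′)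

  floor-step-¬V : ∀ {p k k′} → Floor p k → Floor (suc p) k′ → ¬ V⁺ p → k′ ≡ k
  floor-step-¬V f f′ ¬v =
    ℤ.≤-antisym (<+1⇒≤ (≺⊀⇒< (proj₁ f′) (¬v ∘ from (V⁺⇔ f)))) (floor-suc-≥ f f′)

  Agree : (x y i m : ℕ) → Set
  Agree x y i m = ∀ l → i ℕ.≤ l → l ℕ.< m → V⁺ (l ℕ.+ x) ⇔ V⁺ (l ℕ.+ y)

  floor-gap-step : ∀ {p q a b a′ b′} → V⁺ p ⇔ V⁺ q →
                   Floor p a → Floor q b → Floor (suc p) a′ → Floor (suc q) b′ → b′ - a′ ≡ b - a
  floor-gap-step {p} {q} {a} {b} {a′} {b′} p⇔q fa fb fa′ fb′ =
    decidable-stable (b′ - a′ ℤ.≟ b - a) (¬¬-excluded-middle >>= λ where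
      (yes v) → pure (begin
        b′ - a′               ≡⟨ cong₂ _-_ (floor-step-V fb fb′ (to p⇔q v)) (floor-step-V fa fa′ v) ⟩
        (b + + 1) - (a + + 1) ≡⟨ +1-+1 b a ⟩
        b - a                 ∎)
      (no ¬v) → pure (cong₂ _-_ (floor-step-¬V fb fb′ (¬v ∘ from p⇔q)) (floor-step-¬V fa fa′ ¬v)))
    where
    open ≡-Reasoning
    +1-+1 : ∀ b a → (b + + 1) - (a + + 1) ≡ b - a
    +1-+1 = solve-∀

  floor-gap : ∀ {x y i m a b a′ b′} → Agree x y i m → i ℕ.≤ m →
              Floor (i ℕ.+ x) a → Floor (i ℕ.+ y) b → Floor (m ℕ.+ x) a′ → Floor (m ℕ.+ y) b′ →
              b′ - a′ ≡ b - a
  floor-gap {m = zero} _ z≤n fa fb fa′ fb′ = cong₂ _-_ (floor-unique fb′ fb) (floor-unique fa′ fa)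
  floor-gap {x} {y} {i} {suc m} {a} {b} {a′} {b′} agree i≤1+m fa fb fa′ fb′
    with ℕ.m≤n⇒m<n∨m≡n i≤1+m
  ... | inj₂ refl = cong₂ _-_ (floor-unique fb′ fb) (floor-unique fa′ fa)
  ... | inj₁ i<1+m = decidable-stable (b′ - a′ ℤ.≟ b - a) (
    ¬¬-floor (m ℕ.+ x) >>= λ (a₀ , fa₀) → ¬¬-floor (m ℕ.+ y) >>= λ (b₀ , fb₀) →
    pure (trans (floor-gap-step (agree m i≤m (ℕ.n<1+n m)) fa₀ fb₀ fa′ fb′)
                (floor-gap (λ l i≤l l<m → agree l i≤l (ℕ.m<n⇒m<1+n l<m)) i≤m fa fb fa₀ fb₀)))
    where
    i≤m : i ℕ.≤ m
    i≤m = ℕ.≤-pred i<1+m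

  balanced-floors : ∀ {x y j m a₀ b₀ a₁ b₁ a₂ b₂ a₃ b₃} → j ℕ.< m →
    ¬ V⁺ (j ℕ.+ x) → V⁺ (j ℕ.+ y) → Agree x y (suc j) m → ¬ V⁺ (m ℕ.+ x) → V⁺ (m ℕ.+ y) →
    Floor (j ℕ.+ x) a₀ → Floor (j ℕ.+ y) b₀ → Floor (suc j ℕ.+ x) a₁ → Floor (suc j ℕ.+ y) b₁ →
    Floor (m ℕ.+ x) a₂ → Floor (m ℕ.+ y) b₂ → Floor (suc m ℕ.+ x) a₃ → Floor (suc m ℕ.+ y) b₃ → ⊥
  balanced-floors {x} {y} {j} {m} {a₀} {b₀} {_} {_} {a₂} {b₂} {a₃} {b₃}
    j<m ¬vjx vjy agree ¬vmx vmy fa₀ fb₀ fa₁ fb₁ fa₂ fb₂ fa₃ fb₃ =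
    ℤ.<-irrefl sum (floor-sum-< fb₃ fa₀ fb₀ fa₃ (index m y j x))
    where
    open ≡-Reasoning
    index : ∀ m y j x → suc m ℕ.+ y ℕ.+ suc (j ℕ.+ x) ≡ j ℕ.+ y ℕ.+ suc (suc m ℕ.+ x)
    index = ℕ-Solver.solve-∀
    regroup : ∀ b₂ a₂ a₀ → b₂ + + 1 + a₀ ≡ (b₂ - a₂) + a₀ + (a₂ + + 1)
    regroup = solve-∀
    cancel : ∀ d a₀ e → (d - a₀) + a₀ + e ≡ d + e
    cancel = solve-∀
    gap : b₂ - a₂ ≡ (b₀ + + 1) - a₀
    gap = trans (floor-gap agree j<m fa₁ fb₁ fa₂ fb₂)
                (cong₂ _-_ (floor-step-V fb₀ fb₁ vjy) (floor-step-¬V fa₀ fa₁ ¬vjx))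
    sum : b₃ + a₀ ≡ (b₀ + + 1) + (a₃ + + 1)
    sum = begin
      b₃ + a₀                             ≡⟨ cong (_+ a₀) (floor-step-V fb₂ fb₃ vmy) ⟩
      b₂ + + 1 + a₀                       ≡⟨ regroup b₂ a₂ a₀ ⟩
      (b₂ - a₂) + a₀ + (a₂ + + 1)         ≡⟨ cong₂ (λ g a → g + a₀ + (a + + 1)) gap a₂≡a₃ ⟩
      ((b₀ + + 1) - a₀) + a₀ + (a₃ + + 1) ≡⟨ cancel (b₀ + + 1) a₀ (a₃ + + 1) ⟩
      (b₀ + + 1) + (a₃ + + 1)             ∎
      where
      a₂≡a₃ : a₂ ≡ a₃
      a₂≡a₃ = sym (floor-step-¬V fa₂ fa₃ ¬vmx)

  balanced : ∀ {x y j m} → j ℕ.< m → ¬ V⁺ (j ℕ.+ x) → V⁺ (j ℕ.+ y) → Agree x y (suc j) m →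
             ¬ V⁺ (m ℕ.+ x) → V⁺ (m ℕ.+ y) → ⊥
  balanced {x} {y} {j} {m} j<m ¬vjx vjy agree ¬vmx vmy =
    ¬¬-floor (j ℕ.+ x)     λ (_ , fa₀) → ¬¬-floor (j ℕ.+ y)     λ (_ , fb₀) →
    ¬¬-floor (suc j ℕ.+ x) λ (_ , fa₁) → ¬¬-floor (suc j ℕ.+ y) λ (_ , fb₁) →
    ¬¬-floor (m ℕ.+ x)     λ (_ , fa₂) → ¬¬-floor (m ℕ.+ y)     λ (_ , fb₂) →
    ¬¬-floor (suc m ℕ.+ x) λ (_ , fa₃) → ¬¬-floor (suc m ℕ.+ y) λ (_ , fb₃) →
    balanced-floors j<m ¬vjx vjy agree ¬vmx vmy fa₀ fb₀ fa₁ fb₁ fa₂ fb₂ fa₃ fb₃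

  RightSpecialAt : (x y m : ℕ) → Set
  RightSpecialAt x y m = Agree x y 0 m × V⁺ (m ℕ.+ x) × ¬ V⁺ (m ℕ.+ y)

  right-specials-last-1-0 : ∀ {x₁ y₁ x₂ y₂ j m} → RightSpecialAt x₁ y₁ m → RightSpecialAt x₂ y₂ m →
    j ℕ.< m → V⁺ (j ℕ.+ x₁) → ¬ V⁺ (j ℕ.+ x₂) → Agree x₁ x₂ (suc j) m → ⊥
  right-specials-last-1-0 {j = j} (_ , vm₁ , _) (agree₂ , _ , ¬vm₂) j<m vj₁ ¬vj₂ after =
    balanced j<m (¬vj₂ ∘ from (agree₂ j z≤n j<m)) vj₁
      (λ l j<l l<m → ⇔-sym (after l j<l l<m) ⇔-∘ ⇔-sym (agree₂ l z≤n l<m)) ¬vm₂ vm₁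

  right-special-unique : ∀ {x₁ y₁ x₂ y₂ m} → RightSpecialAt x₁ y₁ m → RightSpecialAt x₂ y₂ m →
                         ¬ ¬ Agree x₁ x₂ 0 m
  right-special-unique {x₁} {_} {x₂} {_} {m} rs₁ rs₂ ¬agree =
    ¬¬-last-failure {λ k → V⁺ (k ℕ.+ x₁) ⇔ V⁺ (k ℕ.+ x₂)} m (λ all → ¬agree (λ l _ → all l))
      λ (j , j<m , differ , after) → ¬⇔⇒¬¬-xor differ λ where
        (inj₁ (vj₁ , ¬vj₂)) → right-specials-last-1-0 rs₁ rs₂ j<m vj₁ ¬vj₂ after
        (inj₂ (¬vj₁ , vj₂)) → right-specials-last-1-0 rs₂ rs₁ j<m vj₂ ¬vj₁
                                 (λ l j<l l<m → ⇔-sym (after l j<l l<m))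

  LetterAt : ℤ → ℕ → Bool → Set
  LetterAt i k c = V α (i + + k) ⇔ (c ≡ true)

  occurs-∷ʳ⁻ : ∀ {m} {u : Vec Bool m} {c i} → OccursAt α (u ∷ʳ c) i → OccursAt α u i × LetterAt i m c
  occurs-∷ʳ⁻ {m} {u} {c} {i} o =
      (λ j → subst₂ (LetterAt i) (toℕ-inject₁ j) (lookup-∷ʳ-inject₁ u c j) (o (inject₁ j)))
    , subst₂ (LetterAt i) (toℕ-fromℕ m) (lookup-∷ʳ-fromℕ u c) (o (fromℕ m))

  occurs-∷ʳ⁺ : ∀ {m} {u : Vec Bool m} {c i} → OccursAt α u i → LetterAt i m c → OccursAt α (u ∷ʳ c) i
  occurs-∷ʳ⁺ {m} {u} {c} {i} o last j with view j
  ... | ‵fromℕ      = subst₂ (LetterAt i) (sym (toℕ-fromℕ m)) (sym (lookup-∷ʳ-fromℕ u c)) last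
  ... | ‵inject₁ j′ = subst₂ (LetterAt i) (sym (toℕ-inject₁ j′)) (sym (lookup-∷ʳ-inject₁ u c j′)) (o j′)

  -- An occurrence at the positive position 1 + x, wrapped so that w and x are inferable.
  infix 4 _occurs-at_
  record _occurs-at_ {n} (w : Vec Bool n) (x : ℕ) : Set where
    constructor occ
    field letters : OccursAt α w (+ suc x)
  open _occurs-at_

  letter : ∀ {m} {u : Vec Bool m} {x} → u occurs-at x → ∀ j → V⁺ (toℕ j ℕ.+ x) ⇔ (lookup u j ≡ true)
  letter {u = u} {x} (occ o) j = subst (λ k → V⁺ k ⇔ (lookup u j ≡ true)) (ℕ.+-comm x (toℕ j)) (o j)

  occurs-at-∷ʳ⁻ : ∀ {m} {u : Vec Bool m} {c x} → u ∷ʳ c occurs-at x → u occurs-at x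
  occurs-at-∷ʳ⁻ {u = u} {c} {x} (occ o) = occ (proj₁ (occurs-∷ʳ⁻ {u = u} {c} {+ suc x} o))

  last-letter : ∀ {m} {u : Vec Bool m} {c x} → u ∷ʳ c occurs-at x → V⁺ (m ℕ.+ x) ⇔ (c ≡ true)
  last-letter {m} {u} {c} {x} (occ o) =
    subst (λ k → V⁺ k ⇔ (c ≡ true)) (ℕ.+-comm x m) (proj₂ (occurs-∷ʳ⁻ {u = u} {c} {+ suc x} o))

  occurs-at-∷ʳ⁺ : ∀ {m} {u : Vec Bool m} {c x} → u occurs-at x → V⁺ (m ℕ.+ x) ⇔ (c ≡ true) →
                  u ∷ʳ c occurs-at x
  occurs-at-∷ʳ⁺ {m} {u} {c} {x} (occ o) last =
    occ (occurs-∷ʳ⁺ {u = u} {c} {+ suc x} o (subst (λ k → V⁺ k ⇔ (c ≡ true)) (ℕ.+-comm m x) last))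

  occurrences-agree : ∀ {m} {u : Vec Bool m} {x y} → u occurs-at x → u occurs-at y → Agree x y 0 m
  occurrences-agree {x = x} {y} ox oy l _ l<m =
    subst (λ k → V⁺ (k ℕ.+ x) ⇔ V⁺ (k ℕ.+ y)) (toℕ-fromℕ< l<m)
      (⇔-sym (letter oy (fromℕ< l<m)) ⇔-∘ letter ox (fromℕ< l<m))

  agree⇒≡ : ∀ {m} {u t : Vec Bool m} {x y} → u occurs-at x → t occurs-at y → Agree x y 0 m → u ≡ t
  agree⇒≡ {u = u} {t} ou ot agree = begin
    u                   ≡⟨ tabulate∘lookup u ⟨
    tabulate (lookup u) ≡⟨ tabulate-cong same-letter ⟩
    tabulate (lookup t) ≡⟨ tabulate∘lookup t ⟩
    t                   ∎
    where
    open ≡-Reasoning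
    same-letter : ∀ j → lookup u j ≡ lookup t j
    same-letter j = ⇔→≡ (letter ot j ⇔-∘ (agree (toℕ j) z≤n (toℕ<n j) ⇔-∘ ⇔-sym (letter ou j)))

  right-special-at : ∀ {m} {u : Vec Bool m} {x y} →
                     u ∷ʳ true occurs-at x → u ∷ʳ false occurs-at y → RightSpecialAt x y m
  right-special-at o₁ o₀ =
      occurrences-agree (occurs-at-∷ʳ⁻ o₁) (occurs-at-∷ʳ⁻ o₀)
    , from (last-letter o₁) refl
    , λ v → contradiction (to (last-letter o₀) v) λ ()

  right-special-word-unique : ∀ {m} {u t : Vec Bool m} {x₁ y₁ x₂ y₂} →
    u ∷ʳ true occurs-at x₁ → u ∷ʳ false occurs-at y₁ →
    t ∷ʳ true occurs-at x₂ → t ∷ʳ false occurs-at y₂ → u ≡ t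
  right-special-word-unique {u = u} {t} ou₁ ou₀ ot₁ ot₀ =
    decidable-stable (Vec.≡-dec Bool._≟_ u t)
      (¬¬-map (agree⇒≡ (occurs-at-∷ʳ⁻ ou₁) (occurs-at-∷ʳ⁻ ot₁))
              (right-special-unique (right-special-at ou₁ ou₀) (right-special-at ot₁ ot₀)))

  extension-unique : ∀ {m} {u t : Vec Bool m} {a b x y c c′} → u ≢ t →
    t ∷ʳ true occurs-at a → t ∷ʳ false occurs-at b → u ∷ʳ c occurs-at x → u ∷ʳ c′ occurs-at y → c ≡ c′
  extension-unique {c = true}  {true}  _   _   _   _  _  = refl
  extension-unique {c = false} {false} _   _   _   _  _  = refl
  extension-unique {c = true}  {false} u≢t ot₁ ot₀ ox oy =
    contradiction (right-special-word-unique ox oy ot₁ ot₀) u≢t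
  extension-unique {c = false} {true}  u≢t ot₁ ot₀ ox oy =
    contradiction (right-special-word-unique oy ox ot₁ ot₀) u≢t

  InPrefix⇒occurs-at : ∀ {N n} (w : Vec Bool n) → InPrefix α N w →
                       ∃ λ x → suc x ℕ.+ n ℕ.≤ suc N × w occurs-at x
  InPrefix⇒occurs-at _ (zero  , ()    , _)
  InPrefix⇒occurs-at _ (suc x , _ , bound , o) = x , bound , occ o

  InPrefix-mono : ∀ {N N′ n} (w : Vec Bool n) → N ℕ.≤ N′ → InPrefix α N w → InPrefix α N′ w
  InPrefix-mono _ N≤N′ (i , 1≤i , bound , o) = i , 1≤i , ℕ.≤-trans bound (s≤s N≤N′) , o

  InPrefix⇒≤ : ∀ {N n} (w : Vec Bool n) → InPrefix α N w → n ℕ.≤ N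
  InPrefix⇒≤ w w∈ with InPrefix⇒occurs-at w w∈
  ... | x , bound , _ = ℕ.m+n≤o⇒n≤o x (ℕ.≤-pred bound)

  InPrefix-∷ʳ⁻ : ∀ {N m} (u : Vec Bool m) c → InPrefix α (suc N) (u ∷ʳ c) → InPrefix α N u
  InPrefix-∷ʳ⁻ {N} {m} u c (i , 1≤i , bound , o) =
      i , 1≤i , ℕ.≤-pred (subst (ℕ._≤ suc (suc N)) (ℕ.+-suc i m) bound)
    , proj₁ (occurs-∷ʳ⁻ {u = u} {c} {+ i} o)

  -- A factor other than t has only one right extension, which therefore follows each of its occurrences.
  InPrefix-∷ʳ⁺ : ∀ {N F G m} {t : Vec Bool m} (u : Vec Bool m) c → u ≢ t → GProp α t G →
                 InPrefix α F (u ∷ʳ c) → InPrefix α N u → ¬ ¬ InPrefix α (suc N) (u ∷ʳ c)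
  InPrefix-∷ʳ⁺ {N} {m = m} {t} u c u≢t (t₁∈ , t₀∈) uc∈ u∈
    with InPrefix⇒occurs-at (t ∷ʳ true) t₁∈ | InPrefix⇒occurs-at (t ∷ʳ false) t₀∈
       | InPrefix⇒occurs-at (u ∷ʳ c) uc∈ | InPrefix⇒occurs-at u u∈
  ... | _ , _ , ot₁ | _ , _ , ot₀ | _ , _ , ouc | x , bound , ou =
    ¬¬-excluded-middle >>= λ d →
      let ou-d = occurs-at-∷ʳ⁺ ou (decided⇔does d)
          ouc-x = subst (λ c → u ∷ʳ c occurs-at x) (extension-unique u≢t ot₁ ot₀ ou-d ouc) ou-d
      in pure (suc x , s≤s z≤n , bound′ , letters ouc-x)
    where
    bound′ : suc x ℕ.+ suc m ℕ.≤ suc (suc N)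
    bound′ = subst (ℕ._≤ suc (suc N)) (sym (ℕ.+-suc (suc x) m)) (s≤s bound)

  ¬¬-extend : ∀ {m} {u : Vec Bool m} → InP α u → ¬ ¬ ∃ λ c → InP α (u ∷ʳ c)
  ¬¬-extend {u = u} (i , o) = ¬¬-excluded-middle >>= λ d →
    pure (does d , i , occurs-∷ʳ⁺ {u = u} {i = i} o (decided⇔does d))

  ¬¬-FProp : ∀ {n N} → (∀ w → InP α w → ¬ ¬ InPrefix α N w) → ¬ ¬ FProp α n N
  ¬¬-FProp {n} h = ¬¬-pull-Vec n (λ w → ¬¬-pull-→ (h w))

  FProp-shorten : ∀ {m N} → FProp α (suc m) (suc N) → ¬ ¬ FProp α m N
  FProp-shorten fP = ¬¬-FProp λ u u∈P →
    ¬¬-extend {u = u} u∈P >>= λ (c , uc∈P) → pure (InPrefix-∷ʳ⁻ u c (fP (u ∷ʳ c) uc∈P))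

  FProp⇒+1≤ : ∀ {m F F′} → IsLeast (FProp α m) F′ → FProp α (suc m) F →
              (w : Vec Bool (suc m)) → InP α w → F′ ℕ.+ 1 ℕ.≤ F
  FProp⇒+1≤ {F = zero} _ fP w w∈P with InPrefix⇒≤ w (fP w w∈P)
  ... | ()
  FProp⇒+1≤ {F = suc F₀} {F′} F′-least fP _ _ =
    subst (ℕ._≤ suc F₀) (ℕ.+-comm 1 F′) (s≤s (least-≤ F′-least (FProp-shorten fP)))

  -- fP only serves to move occurrences from arbitrary positions in ℤ to positive ones.
  FProp-bound : ∀ {m F F′ G M} {t : Vec Bool m} → FProp α (suc m) F → FProp α m F′ → GProp α t G →
                F′ ℕ.+ 1 ℕ.≤ M → G ℕ.≤ M → ¬ ¬ FProp α (suc m) M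
  FProp-bound {m} {F′ = F′} {M = M} {t} fP fP′ (t₁∈ , t₀∈) F′+1≤M G≤M = ¬¬-FProp occurs
    where
    1+F′≤M : suc F′ ℕ.≤ M
    1+F′≤M = subst (ℕ._≤ M) (ℕ.+-comm F′ 1) F′+1≤M

    occurs : (w : Vec Bool (suc m)) → InP α w → ¬ ¬ InPrefix α M w
    occurs w w∈P with initLast w
    ... | u , c , refl with Vec.≡-dec Bool._≟_ u t
    ...   | yes refl with c
    ...     | true  = pure (InPrefix-mono (t ∷ʳ true) G≤M t₁∈)
    ...     | false = pure (InPrefix-mono (t ∷ʳ false) G≤M t₀∈)
    occurs w (i , o) | u , c , refl | no u≢t =
      ¬¬-map (InPrefix-mono (u ∷ʳ c) 1+F′≤M) (InPrefix-∷ʳ⁺ u c u≢t (t₁∈ , t₀∈) (fP w (i , o)) (fP′ u u∈P))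
      where
      u∈P : InP α u
      u∈P = i , proj₁ (occurs-∷ʳ⁻ {u = u} {c} {i} o)

lemma3p3 : (α : Irrational01) → (n : ℕ) → 2 ℕ.≤ n →
    (t : Vec Bool (n ℕ.∸ 1)) → RightSpecial α t →
    (F F′ G : ℕ) →
    IsLeast (FProp α n) F → IsLeast (FProp α (n ℕ.∸ 1)) F′ → IsLeast (GProp α t) G →
    IsLeast (λ N → (F′ ℕ.+ 1 ℕ.≤ N) × (G ℕ.≤ N)) F
lemma3p3 α (suc (suc m)) (s≤s (s≤s z≤n)) t (t₁∈P , t₀∈P) F F′ G (fP , F-least) F′-least (gP , G-least) =
    (FProp⇒+1≤ F′-least fP (t ∷ʳ true) t₁∈P , G-least F (fP (t ∷ʳ true) t₁∈P , fP (t ∷ʳ false) t₀∈P))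
  , λ M (F′+1≤M , G≤M) → least-≤ (fP , F-least) (FProp-bound {t = t} fP (proj₁ F′-least) gP F′+1≤M G≤M)
  where open Sturmian α
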